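{- For every planar binary rooted tree $t\in\mathbf{PBT}_n$ ($n\geq 1$), $$\overset{\circledast}{\Delta}(M_t)=\sum_{z_1\rightthreetimes z_2=t} M_{z_1}\otimes M_{z_2},$$ where the sum runs over all pairs $(z_1,z_2)$ with $z_1,z_2\in\{1_{\mathbb K}\}\cup\bigcup_{m\geq1}\mathbf{PBT}_m$ such that $z_1\rightthreetimes z_2=t$, and $M_{1_{\mathbb K}}:=1_{\mathbb K}$.
   Context: A planar binary rooted tree is a planar rooted tree in which every internal vertex has exactly two incoming edges (children) and one outgoing edge; $\mathbf{PBT}_n$ is the set of such trees with $n$ leaves (hence $n-1$ internal vertices), leaves numbered $1,\dots,n$ from left to right; $\mathbf{PBT}_1=\{\vert\}$ (the tree with one leaf and no internal vertex). For trees $t,w$, $t\veebar w$ is the tree obtained by joining the roots of $t$ (on the left) and $w$ (on the right) to a new root; every tree with at least two leaves is uniquely $t^l\veebar t^r$. For $t\in\mathbf{PBT}_n$, $w$ a tree, $1\le j\le n$, $t\circ_j w$ is the tree obtained by identifying the root of $w$ with the $j$-th leaf of $t$. Let $\mathcal H=\mathbb K 1_{\mathbb K}\oplus\bigoplus_{n\ge1}\mathbb K[\mathbf{PBT}_n]$ ($1_{\mathbb K}$ of degree $0$); all operations are extended (multi)linearly. The product $\rightthreetimes$ on $\mathcal H$: $1_{\mathbb K}\rightthreetimes t=t=t\rightthreetimes 1_{\mathbb K}$, and $t\rightthreetimes w=w\circ_1(t\veebar\vert)$ for trees $t,w$. The coproduct $\overset{\circledast}{\Delta}:\mathcal H\to\mathcal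 H\otimes\mathcal H$ is defined recursively by $\overset{\circledast}{\Delta}(1_{\mathbb K})=1_{\mathbb K}\otimes1_{\mathbb K}$, $\overset{\circledast}{\Delta}(\vert)=1_{\mathbb K}\otimes\vert+\vert\otimes1_{\mathbb K}$, and $\overset{\circledast}{\Delta}(t\veebar w)=\sum t_{(1)}\otimes(t_{(2)}\veebar w)+\sum(t\veebar w_{(1)})\otimes w_{(2)}-t\otimes w$, where $\overset{\circledast}{\Delta}(x)=\sum x_{(1)}\otimes x_{(2)}$ and with the conventions $1_{\mathbb K}\veebar w=w$, $t\veebar 1_{\mathbb K}=t$. The Tamari order $\le_T$ on $\mathbf{PBT}_n$ is the partial order generated by $(t_1\veebar t_2)\veebar t_3\le_T t_1\veebar(t_2\veebar t_3)$ and by: $t_1\le_T w_1$, $t_2\le_T w_2$ imply $t_1\veebar t_2\le_T w_1\veebar w_2$ (equivalently, the reflexive–transitive closure of right rotations at internal vertices). With $\mu$ the Möbius function of $(\mathbf{PBT}_n,\le_T)$, $M_t:=\sum_{w\le_T t}\mu(w,t)\,w$. -}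

module Defs where

open import Data.Nat using (ℕ; zero; suc; _+_)
import Level
import Data.Nat as ℕ
open import Data.Integer using (ℤ; -_; _*_) renaming (_+_ to _+ℤ_)
open import Data.List using (List; []; _∷_; _++_; map; concatMap; filter; length)
open import Data.Maybe using (Maybe; just; nothing)
open import Data.Product using (_×_; _,_)
open import Data.Bool using (Bool; true; false; if_then_else_; _∧_)
open import Relation.Nullary using (Dec; yes; no; does; ¬_)
open import Relation.Nullary.Decidable using (⌊_⌋; T?)
open import Relation.Binary using (Rel; Decidable)
open import Relation.Binary.PropositionalEquality using (_≡_; refl; cong; cong₂)
open import Relation.Binary.Construct.Closure.ReflexiveTransitive using (Star)

data Tree : Set where
  leaf : Tree
  _∨̲_  : Tree → Tree → Tree

infixr 6 _∨̲_

leaves : Tree → ℕ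
leaves leaf      = 1
leaves (t ∨̲ w)  = leaves t + leaves w

∨̲-injˡ : ∀ {a b c d} → a ∨̲ b ≡ c ∨̲ d → a ≡ c
∨̲-injˡ refl = refl

∨̲-injʳ : ∀ {a b c d} → a ∨̲ b ≡ c ∨̲ d → b ≡ d
∨̲-injʳ refl = refl

_≟T_ : (s t : Tree) → Dec (s ≡ t)
leaf ≟T leaf = yes refl
leaf ≟T (_ ∨̲ _) = no (λ ())
(_ ∨̲ _) ≟T leaf = no (λ ())
(a ∨̲ b) ≟T (c ∨̲ d) with a ≟T c | b ≟T d
... | yes refl | yes refl = yes refl
... | no ¬p    | _        = no (λ e → ¬p (∨̲-injˡ e))
... | yes _    | no ¬q    = no (λ e → ¬q (∨̲-injʳ e))

treesOfHeight≤ : ℕ → List Tree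
treesOfHeight≤ zero    = leaf ∷ []
treesOfHeight≤ (suc h) =
  leaf ∷ concatMap (λ a → map (λ b → a ∨̲ b) (treesOfHeight≤ h)) (treesOfHeight≤ h)

-- PBT n : the list of all planar binary trees with n leaves
-- (such a tree has height ≤ n, so it occurs exactly once in treesOfHeight≤ n)
PBT : ℕ → List Tree
PBT n = filter (λ t → leaves t ℕ.≟ n) (treesOfHeight≤ n)

-- Tamari order: reflexive–transitive closure of right rotations
-- performed at any internal vertex.

data _⇒R_ : Rel Tree Level.zero where
  rot   : ∀ {a b c} → ((a ∨̲ b) ∨̲ c) ⇒R (a ∨̲ (b ∨̲ c))
  left  : ∀ {a a' b} → a ⇒R a' → (a ∨̲ b) ⇒R (a' ∨̲ b)
  right : ∀ {a b b'} → b ⇒R b' → (a ∨̲ b) ⇒R (a ∨̲ b')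

_≤T_ : Rel Tree Level.zero
_≤T_ = Star _⇒R_

-- The recursion goes up strict chains inside PBT_n, whose length is
-- < |PBT_n|, so the fuel |PBT_n| + 1 is always sufficient.

module Möbius (_≤?_ : Decidable _≤T_) where

  sumℤ : List ℤ → ℤ
  sumℤ []       = Data.Integer.0ℤ
  sumℤ (x ∷ xs) = x +ℤ sumℤ xs

  mobF : ℕ → Tree → Tree → ℤ
  mobF zero    w t = Data.Integer.0ℤ
  mobF (suc k) w t with w ≟T t
  ... | yes _ = Data.Integer.1ℤ
  ... | no _  with w ≤? t
  ...   | no _  = Data.Integer.0ℤ
  ...   | yes _ =
    - sumℤ (map (λ z → mobF k z t)
                (filter (λ z → T? (⌊ w ≤? z ⌋ ∧ ⌊ z ≤? t ⌋ ∧ Data.Bool.not ⌊ z ≟T w ⌋))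
                        (PBT (leaves t))))

  μ : Tree → Tree → ℤ
  μ w t = mobF (suc (length (PBT (leaves t)))) w t

-- The vector space H with basis {1_K} ∪ ⋃_{n≥1} PBT_n, with integer
-- coefficients (all structure constants and Möbius values are integers).
-- Basis element: nothing = 1_K, just t = the tree t.

Basis : Set
Basis = Maybe Tree

_≟B_ : (x y : Basis) → Dec (x ≡ y)
nothing ≟B nothing = yes refl
nothing ≟B just _  = no (λ ())
just _  ≟B nothing = no (λ ())
just s  ≟B just t with s ≟T t
... | yes refl = yes refl
... | no ¬p    = no (λ { refl → ¬p refl })

H : Set
H = List (ℤ × Basis)

H⊗H : Set
H⊗H = List (ℤ × Basis × Basis)

coeff : H⊗H → Basis → Basis → ℤ
coeff []                  x y = Data.Integer.0ℤ
coeff ((c , a , b) ∷ xs)  x y with a ≟B x | b ≟B y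
... | yes _ | yes _ = c +ℤ coeff xs x y
... | _     | _     = coeff xs x y

_⊗_ : H → H → H⊗H
u ⊗ v = concatMap (λ { (c , a) → map (λ { (d , b) → (c * d , a , b) }) v }) u

_∨̲B_ : Basis → Basis → Basis
nothing ∨̲B w       = w
just t  ∨̲B nothing = just t
just t  ∨̲B just w  = just (t ∨̲ w)

Δtree : Tree → H⊗H
Δtree leaf    = (Data.Integer.1ℤ , nothing , just leaf) ∷ (Data.Integer.1ℤ , just leaf , nothing) ∷ []
Δtree (t ∨̲ w) =
     map (λ { (c , a , b) → (c , a , b ∨̲B just w) }) (Δtree t)
  ++ map (λ { (c , a , b) → (c , just t ∨̲B a , b) }) (Δtree w)
  ++ ((- Data.Integer.1ℤ) , just t , just w) ∷ []

ΔB : Basis → H⊗H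
ΔB nothing  = (Data.Integer.1ℤ , nothing , nothing) ∷ []
ΔB (just t) = Δtree t

Δ : H → H⊗H
Δ u = concatMap (λ { (c , x) → map (λ { (d , a , b) → (c * d , a , b) }) (ΔB x) }) u

graft₁ : Tree → Tree → Tree
graft₁ leaf    s = s
graft₁ (l ∨̲ r) s = graft₁ l s ∨̲ r

_⋌_ : Basis → Basis → Basis
nothing ⋌ z       = z
just t  ⋌ nothing = just t
just t  ⋌ just w  = just (graft₁ w (t ∨̲ leaf))

basis≤ : ℕ → List Basis
basis≤ zero    = nothing ∷ []
basis≤ (suc n) = basis≤ n ++ map just (PBT (suc n))

module MBasis (_≤?_ : Decidable _≤T_) where
  open Möbius _≤?_ public

  -- M_t = Σ_{w ≤T t} μ(w,t) w  (μ(w,t) = 0 unless w ≤T t), M_1 = 1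
  M : Basis → H
  M nothing  = (Data.Integer.1ℤ , nothing) ∷ []
  M (just t) = map (λ w → (μ w t , just w)) (PBT (leaves t))

  -- Σ_{z₁ ⋌ z₂ = t} M_{z₁} ⊗ M_{z₂}.  Since deg(z₁ ⋌ z₂) = deg z₁ + deg z₂,
  -- only z₁, z₂ of degree ≤ deg t can contribute.
  rhs : Tree → H⊗H
  rhs t = concatMap (λ z₁ → concatMap (λ z₂ → M z₁ ⊗ M z₂)
                      (filter (λ z₂ → (z₁ ⋌ z₂) ≟B just t) (basis≤ (leaves t))))
                    (basis≤ (leaves t))

-- Pair H ⊗ H with the functionals ζ_u ⊗ ζ_v, where ζ_u(x) = [u ≤ x] for the Tamari
-- order (the unit 1 being comparable only with itself).  The terms of ⊛Δ(w) are the
-- cuts of w between two consecutive leaves, and u ⋌ v ≤ w holds exactly when (u , v)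
-- lies below the cut of w after its (deg u)-th leaf.  Hence ⊛Δ is adjoint to ⋌:
-- ⟪ ⊛Δ(U) , ζ_u ⊗ ζ_v ⟫ = ⟨ U , ζ_{u ⋌ v} ⟩.  Möbius inversion gives ⟨ M_z , ζ_u ⟩ = [u = z],
-- so both sides of the identity pair to [u ⋌ v = t] with every ζ_u ⊗ ζ_v; since ζ is
-- unitriangular, these pairings determine all coefficients.

{-# OPTIONS --safe #-}
module Submission where

open import Defs
open import Relation.Binary using (Decidable)
open import Data.Maybe using (just)
open import Relation.Binary.PropositionalEquality using (_≡_)

open import Data.Bool using (true; false; if_then_else_; T; not; _∧_)
open import Data.Empty using (⊥-elim)
open import Data.Integer using (ℤ; 0ℤ; 1ℤ; -_; _*_; _+_; _-_)
open import Data.Integer.Properties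
  using (+-identityˡ; +-identityʳ; +-assoc; *-identityˡ; *-identityʳ; *-zeroˡ; *-zeroʳ;
         *-assoc; *-comm; *-distribˡ-+; +-inverseˡ; i-j≡0⇒i≡j; i≡j⇒i-j≡0)
open import Data.Integer.Tactic.RingSolver using (solve-∀)
open import Data.List using (List; []; _∷_; _++_; map; concatMap; filter; length)
open import Data.List.Membership.Propositional using (_∈_)
open import Data.List.Membership.Propositional.Properties using (∈-filter⁻)
open import Data.List.Properties using (map-cong-local; length-filter)
import Data.List.Relation.Unary.All as All
open import Data.List.Relation.Unary.Any using (here; there)
open import Data.Maybe using (nothing)
open import Data.Maybe.Properties using (just-injective)
import Data.Maybe.Relation.Binary.Pointwise as MaybeRel
open import Data.Nat as ℕ using (ℕ; zero; suc; _≤_; _<_; _∸_; s≤s; z≤n)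
open import Data.Nat.Induction using (<-wellFounded)
import Data.Nat.Properties as ℕ
import Data.Nat.Tactic.RingSolver as ℕ-Ring
open import Data.Product using (_×_; _,_; proj₁; proj₂; uncurry)
import Data.Product.Relation.Binary.Pointwise.NonDependent as ×Rel
open import Function using (_∘_; _⇔_; mk⇔; Equivalence)
open import Induction.WellFounded using (Acc; acc)
open import Level using (0ℓ)
open import Relation.Binary using (Rel)
open import Relation.Binary.Construct.Closure.ReflexiveTransitive using (ε; _◅_; _◅◅_; gmap)
open import Relation.Binary.PropositionalEquality
  using (_≢_; refl; sym; trans; cong; cong₂; subst; module ≡-Reasoning)
open import Relation.Nullary using (Dec; yes; no; does; ¬_)
open import Relation.Nullary.Decidable using (_×-dec_; ⌊_⌋; T?)
open import Relation.Unary using (Pred)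

-- Finite sums and indicators

∑ : {A : Set} → List A → (A → ℤ) → ℤ
∑ []       f = 0ℤ
∑ (x ∷ xs) f = f x + ∑ xs f

module _ {A : Set} where

  ∑-++ : (xs ys : List A) (f : A → ℤ) → ∑ (xs ++ ys) f ≡ ∑ xs f + ∑ ys f
  ∑-++ []       ys f = sym (+-identityˡ _)
  ∑-++ (x ∷ xs) ys f = trans (cong (f x +_) (∑-++ xs ys f)) (sym (+-assoc (f x) _ _))

  ∑-cong : (xs : List A) {f g : A → ℤ} → (∀ x → f x ≡ g x) → ∑ xs f ≡ ∑ xs g
  ∑-cong []       f≗g = refl
  ∑-cong (x ∷ xs) f≗g = cong₂ _+_ (f≗g x) (∑-cong xs f≗g)

  ∑-zero : (xs : List A) {f : A → ℤ} → (∀ x → f x ≡ 0ℤ) → ∑ xs f ≡ 0ℤ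
  ∑-zero []       f≗0 = refl
  ∑-zero (x ∷ xs) f≗0 = cong₂ _+_ (f≗0 x) (∑-zero xs f≗0)

  ∑-distrib-+ : (xs : List A) (f g : A → ℤ) → ∑ xs (λ x → f x + g x) ≡ ∑ xs f + ∑ xs g
  ∑-distrib-+ []       f g = refl
  ∑-distrib-+ (x ∷ xs) f g =
    trans (cong (f x + g x +_) (∑-distrib-+ xs f g)) (interchange (f x) (g x) (∑ xs f) (∑ xs g))
    where
    interchange : ∀ a b c d → (a + b) + (c + d) ≡ (a + c) + (b + d)
    interchange = solve-∀

  *-distribˡ-∑ : (c : ℤ) (xs : List A) (f : A → ℤ) → c * ∑ xs f ≡ ∑ xs (λ x → c * f x)
  *-distribˡ-∑ c []       f = *-zeroʳ c
  *-distribˡ-∑ c (x ∷ xs) f = trans (*-distribˡ-+ c (f x) _) (cong (c * f x +_) (*-distribˡ-∑ c xs f))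

  *-distribʳ-∑ : (c : ℤ) (xs : List A) (f : A → ℤ) → ∑ xs f * c ≡ ∑ xs (λ x → f x * c)
  *-distribʳ-∑ c xs f =
    trans (*-comm (∑ xs f) c) (trans (*-distribˡ-∑ c xs f) (∑-cong xs (λ x → *-comm c (f x))))

module _ {A B : Set} where

  ∑-map : (g : A → B) (xs : List A) (f : B → ℤ) → ∑ (map g xs) f ≡ ∑ xs (f ∘ g)
  ∑-map g []       f = refl
  ∑-map g (x ∷ xs) f = cong (f (g x) +_) (∑-map g xs f)

  ∑-concatMap : (g : A → List B) (xs : List A) (f : B → ℤ) →
                ∑ (concatMap g xs) f ≡ ∑ xs (λ x → ∑ (g x) f)
  ∑-concatMap g []       f = refl
  ∑-concatMap g (x ∷ xs) f =
    trans (∑-++ (g x) (concatMap g xs) f) (cong (∑ (g x) f +_) (∑-concatMap g xs f))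

𝟙 : {P : Set} → Dec P → ℤ
𝟙 P? = if does P? then 1ℤ else 0ℤ

𝟙-yes : {P : Set} (P? : Dec P) → P → 𝟙 P? ≡ 1ℤ
𝟙-yes (yes _) p = refl
𝟙-yes (no ¬p) p = ⊥-elim (¬p p)

𝟙-no : {P : Set} (P? : Dec P) → ¬ P → 𝟙 P? ≡ 0ℤ
𝟙-no (yes p) ¬p = ⊥-elim (¬p p)
𝟙-no (no _)  ¬p = refl

𝟙-⇔ : {P Q : Set} (P? : Dec P) (Q? : Dec Q) → P ⇔ Q → 𝟙 P? ≡ 𝟙 Q?
𝟙-⇔ P? Q? P⇔Q with P? | Q?
... | yes _ | yes _ = refl
... | no  _ | no  _ = refl
... | yes p | no ¬q = ⊥-elim (¬q (Equivalence.to P⇔Q p))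
... | no ¬p | yes q = ⊥-elim (¬p (Equivalence.from P⇔Q q))

𝟙-× : {P Q : Set} (P? : Dec P) (Q? : Dec Q) → 𝟙 P? * 𝟙 Q? ≡ 𝟙 (P? ×-dec Q?)
𝟙-× P? Q? with P? | Q?
... | yes _ | yes _ = refl
... | yes _ | no  _ = refl
... | no  _ | _     = refl

∑-filter : {A : Set} {P : Pred A _} (P? : ∀ x → Dec (P x)) (xs : List A) (f : A → ℤ) →
           ∑ (filter P? xs) f ≡ ∑ xs (λ x → 𝟙 (P? x) * f x)
∑-filter P? []       f = refl
∑-filter P? (x ∷ xs) f with does (P? x)
... | true  = cong₂ _+_ (sym (*-identityˡ (f x))) (∑-filter P? xs f)
... | false = trans (∑-filter P? xs f) (sym (+-identityˡ _))

module _ {A : Set} {P Q : Pred A 0ℓ} (P? : ∀ x → Dec (P x)) (Q? : ∀ x → Dec (Q x))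
         (P⊆Q : ∀ {x} → P x → Q x) where

  length-filter-mono : ∀ xs → length (filter P? xs) ≤ length (filter Q? xs)
  length-filter-mono []       = z≤n
  length-filter-mono (x ∷ xs) with P? x | Q? x
  ... | yes _ | yes _  = s≤s (length-filter-mono xs)
  ... | yes p | no  ¬q = ⊥-elim (¬q (P⊆Q p))
  ... | no  _ | yes _  = ℕ.m≤n⇒m≤1+n (length-filter-mono xs)
  ... | no  _ | no  _  = length-filter-mono xs

  length-filter-strict : ∀ {x xs} → x ∈ xs → Q x → ¬ P x → length (filter P? xs) < length (filter Q? xs)
  length-filter-strict {x} {y ∷ xs} (here refl) qx ¬px with P? y | Q? y
  ... | yes px | _      = ⊥-elim (¬px px)
  ... | no  _  | yes _  = s≤s (length-filter-mono xs)
  ... | no  _  | no ¬qx = ⊥-elim (¬qx qx)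
  length-filter-strict {x} {y ∷ xs} (there x∈xs) qx ¬px with P? y | Q? y
  ... | yes _ | yes _  = s≤s (length-filter-strict x∈xs qx ¬px)
  ... | yes p | no  ¬q = ⊥-elim (¬q (P⊆Q p))
  ... | no  _ | yes _  = ℕ.m≤n⇒m≤1+n (length-filter-strict x∈xs qx ¬px)
  ... | no  _ | no  _  = length-filter-strict x∈xs qx ¬px

module _ {A : Set} (_≟_ : (x y : A) → Dec (x ≡ y)) where

  multiplicity : A → List A → ℤ
  multiplicity a xs = ∑ xs (λ x → 𝟙 (a ≟ x))

  ∑-supported : (xs : List A) (a : A) (f : A → ℤ) → (∀ x → x ≢ a → f x ≡ 0ℤ) →
                ∑ xs f ≡ multiplicity a xs * f a
  ∑-supported []       a f f≗0 = refl
  ∑-supported (x ∷ xs) a f f≗0 with a ≟ x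
  ... | yes refl = trans (cong (f a +_) (∑-supported xs a f f≗0)) (one+m*f (f a) (multiplicity a xs))
    where
    one+m*f : ∀ b m → b + m * b ≡ (1ℤ + m) * b
    one+m*f = solve-∀
  ... | no a≢x   = trans (cong₂ _+_ (f≗0 x (a≢x ∘ sym)) (∑-supported xs a f f≗0))
                          (trans (+-identityˡ _) (cong (_* f a) (sym (+-identityˡ (multiplicity a xs)))))

  ∑-pick : (xs : List A) (a : A) (f : A → ℤ) → ∑ xs (λ x → 𝟙 (a ≟ x) * f x) ≡ multiplicity a xs * f a
  ∑-pick xs a f = trans (∑-supported xs a _ (λ x x≢a → cong (_* f x) (𝟙-no (a ≟ x) (x≢a ∘ sym))))
                        (cong (multiplicity a xs *_) (trans (cong (_* f a) (𝟙-yes (a ≟ a) refl)) (*-identityˡ (f a))))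

  multiplicity≢0⇒∈ : ∀ a xs → multiplicity a xs ≢ 0ℤ → a ∈ xs
  multiplicity≢0⇒∈ a []       m≢0 = ⊥-elim (m≢0 refl)
  multiplicity≢0⇒∈ a (x ∷ xs) m≢0 with a ≟ x
  ... | yes refl = here refl
  ... | no _     = there (multiplicity≢0⇒∈ a xs (m≢0 ∘ trans (+-identityˡ _)))

∑< : ℕ → (ℕ → ℤ) → ℤ
∑< zero    f = 0ℤ
∑< (suc n) f = f 0 + ∑< n (f ∘ suc)

∑<-+ : ∀ m n f → ∑< (m ℕ.+ n) f ≡ ∑< m f + ∑< n (λ j → f (m ℕ.+ j))
∑<-+ zero    n f = sym (+-identityˡ _)
∑<-+ (suc m) n f = trans (cong (f 0 +_) (∑<-+ m n (f ∘ suc))) (sym (+-assoc (f 0) _ _))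

∑<-cong : ∀ n {f g} → (∀ j → j < n → f j ≡ g j) → ∑< n f ≡ ∑< n g
∑<-cong zero    f≗g = refl
∑<-cong (suc n) f≗g = cong₂ _+_ (f≗g 0 (s≤s z≤n)) (∑<-cong n (λ j j<n → f≗g (suc j) (s≤s j<n)))

∑<-zero : ∀ n {f} → (∀ j → j < n → f j ≡ 0ℤ) → ∑< n f ≡ 0ℤ
∑<-zero zero    f≗0 = refl
∑<-zero (suc n) f≗0 = cong₂ _+_ (f≗0 0 (s≤s z≤n)) (∑<-zero n (λ j j<n → f≗0 (suc j) (s≤s j<n)))

∑<-supported : ∀ n k f → (∀ j → j < n → j ≢ k → f j ≡ 0ℤ) → ∑< n f ≡ 𝟙 (k ℕ.<? n) * f k
∑<-supported zero    k       f f≗0 = refl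
∑<-supported (suc n) zero    f f≗0 =
  trans (cong (f 0 +_) (∑<-zero n (λ j j<n → f≗0 (suc j) (s≤s j<n) (λ ()))))
        (trans (+-identityʳ _) (sym (*-identityˡ _)))
∑<-supported (suc n) (suc k) f f≗0 =
  trans (cong₂ _+_ (f≗0 0 (s≤s z≤n) (λ ()))
                   (∑<-supported n k (f ∘ suc) (λ j j<n j≢k → f≗0 (suc j) (s≤s j<n) (j≢k ∘ ℕ.suc-injective))))
        (+-identityˡ _)

-- Tamari order

0<leaves : ∀ t → 0 < leaves t
0<leaves leaf    = s≤s z≤n
0<leaves (a ∨̲ b) = ℕ.<-≤-trans (0<leaves a) (ℕ.m≤m+n (leaves a) (leaves b))

⇒R-leaves : ∀ {s t} → s ⇒R t → leaves s ≡ leaves t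
⇒R-leaves (rot {a} {b} {c}) = ℕ.+-assoc (leaves a) (leaves b) (leaves c)
⇒R-leaves (left {b = b} p)  = cong (ℕ._+ leaves b) (⇒R-leaves p)
⇒R-leaves (right {a = a} p) = cong (leaves a ℕ.+_) (⇒R-leaves p)

≤T-leaves : ∀ {s t} → s ≤T t → leaves s ≡ leaves t
≤T-leaves ε        = refl
≤T-leaves (p ◅ ps) = trans (⇒R-leaves p) (≤T-leaves ps)

-- Φ counts, over all internal vertices, the leaves of the left subtree;
-- a rotation at (a ∨̲ b) ∨̲ c lowers it by leaves a.
Φ : Tree → ℕ
Φ leaf    = 0
Φ (a ∨̲ b) = leaves a ℕ.+ Φ a ℕ.+ Φ b

⇒R-Φ : ∀ {s t} → s ⇒R t → Φ t < Φ s
⇒R-Φ (rot {a} {b} {c}) =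
  subst (Φ (a ∨̲ (b ∨̲ c)) <_) (rotated (leaves a) (leaves b) (Φ a) (Φ b) (Φ c))
        (ℕ.m<n+m (Φ (a ∨̲ (b ∨̲ c))) (0<leaves a))
  where
  rotated : ∀ la lb pa pb pc → la ℕ.+ (la ℕ.+ pa ℕ.+ (lb ℕ.+ pb ℕ.+ pc)) ≡ (la ℕ.+ lb) ℕ.+ (la ℕ.+ pa ℕ.+ pb) ℕ.+ pc
  rotated = ℕ-Ring.solve-∀
⇒R-Φ (left {a} {a'} {b} p) rewrite ⇒R-leaves p =
  ℕ.+-monoˡ-< (Φ b) (ℕ.+-monoʳ-< (leaves a') (⇒R-Φ p))
⇒R-Φ (right {a} p) = ℕ.+-monoʳ-< (leaves a ℕ.+ Φ a) (⇒R-Φ p)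

≤T-Φ : ∀ {s t} → s ≤T t → Φ t ≤ Φ s
≤T-Φ ε        = ℕ.≤-refl
≤T-Φ (p ◅ ps) = ℕ.≤-trans (≤T-Φ ps) (ℕ.<⇒≤ (⇒R-Φ p))

<T-Φ : ∀ {s t} → s ≤T t → s ≢ t → Φ t < Φ s
<T-Φ ε        s≢t = ⊥-elim (s≢t refl)
<T-Φ (p ◅ ps) _   = ℕ.≤-<-trans (≤T-Φ ps) (⇒R-Φ p)

≤T-antisym : ∀ {s t} → s ≤T t → t ≤T s → s ≡ t
≤T-antisym ε        _   = refl
≤T-antisym (p ◅ ps) t≤s = ⊥-elim (ℕ.<-irrefl refl (ℕ.<-≤-trans (⇒R-Φ p) (ℕ.≤-trans (≤T-Φ t≤s) (≤T-Φ ps))))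

∨̲-monoˡ-≤T : ∀ {a a'} b → a ≤T a' → (a ∨̲ b) ≤T (a' ∨̲ b)
∨̲-monoˡ-≤T b = gmap (_∨̲ b) left

∨̲-monoʳ-≤T : ∀ a {b b'} → b ≤T b' → (a ∨̲ b) ≤T (a ∨̲ b')
∨̲-monoʳ-≤T a = gmap (a ∨̲_) right

rotation : ∀ {a b c} → ((a ∨̲ b) ∨̲ c) ≤T (a ∨̲ (b ∨̲ c))
rotation = rot ◅ ε

graft₁-monoˡ-≤T : ∀ {b b'} c → b ≤T b' → graft₁ b c ≤T graft₁ b' c
graft₁-monoˡ-≤T c = gmap (λ b → graft₁ b c) step
  where
  step : ∀ {b b'} → b ⇒R b' → graft₁ b c ⇒R graft₁ b' c
  step rot       = rot
  step (left p)  = left (step p)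
  step (right p) = right p

graft₁-monoʳ-≤T : ∀ b {c c'} → c ≤T c' → graft₁ b c ≤T graft₁ b c'
graft₁-monoʳ-≤T b = gmap (graft₁ b) (step b)
  where
  step : ∀ b {c c'} → c ⇒R c' → graft₁ b c ⇒R graft₁ b c'
  step leaf    p = p
  step (b ∨̲ _) p = left (step b p)

graft₁-∨̲leaf-≤T : ∀ b a → graft₁ b (a ∨̲ leaf) ≤T (a ∨̲ b)
graft₁-∨̲leaf-≤T leaf      a = ε
graft₁-∨̲leaf-≤T (b₁ ∨̲ b₂) a = ∨̲-monoˡ-≤T b₂ (graft₁-∨̲leaf-≤T b₁ a) ◅◅ rotation

graft₁-∨̲-≤T : ∀ b l c → graft₁ b (l ∨̲ c) ≤T (l ∨̲ graft₁ b c)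
graft₁-∨̲-≤T leaf      l c = ε
graft₁-∨̲-≤T (b₁ ∨̲ b₂) l c = ∨̲-monoˡ-≤T b₂ (graft₁-∨̲-≤T b₁ l c) ◅◅ rotation

leaves-graft₁ : ∀ b c → suc (leaves (graft₁ b c)) ≡ leaves b ℕ.+ leaves c
leaves-graft₁ leaf      c = refl
leaves-graft₁ (b₁ ∨̲ b₂) c =
  trans (cong (ℕ._+ leaves b₂) (leaves-graft₁ b₁ c)) (swap (leaves b₁) (leaves c) (leaves b₂))
  where
  swap : ∀ x y z → x ℕ.+ y ℕ.+ z ≡ x ℕ.+ z ℕ.+ y
  swap = ℕ-Ring.solve-∀

deg : Basis → ℕ
deg nothing  = 0
deg (just t) = leaves t

infix 4 _≤B_
_≤B_ : Rel Basis 0ℓ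
_≤B_ = MaybeRel.Pointwise _≤T_

≤B-refl : ∀ {x} → x ≤B x
≤B-refl = MaybeRel.refl ε

≤B-trans : ∀ {x y z} → x ≤B y → y ≤B z → x ≤B z
≤B-trans = MaybeRel.trans _◅◅_

≤B-deg : ∀ {x y} → x ≤B y → deg x ≡ deg y
≤B-deg (MaybeRel.just s≤t) = ≤T-leaves s≤t
≤B-deg MaybeRel.nothing    = refl

ΦB : Basis → ℕ
ΦB nothing  = 0
ΦB (just t) = Φ t

<B-ΦB : ∀ {x y} → x ≤B y → x ≢ y → ΦB y < ΦB x
<B-ΦB (MaybeRel.just s≤t) x≢y = <T-Φ s≤t (x≢y ∘ cong just)
<B-ΦB MaybeRel.nothing    x≢y = ⊥-elim (x≢y refl)

⋌-deg : ∀ u v → deg (u ⋌ v) ≡ deg u ℕ.+ deg v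
⋌-deg nothing  v        = refl
⋌-deg (just a) nothing  = sym (ℕ.+-identityʳ (leaves a))
⋌-deg (just a) (just b) = ℕ.suc-injective (trans (leaves-graft₁ b (a ∨̲ leaf)) (moved (leaves b) (leaves a)))
  where
  moved : ∀ m n → m ℕ.+ (n ℕ.+ 1) ≡ suc (n ℕ.+ m)
  moved = ℕ-Ring.solve-∀

⋌-mono : ∀ {u u' v v'} → u ≤B u' → v ≤B v' → (u ⋌ v) ≤B (u' ⋌ v')
⋌-mono MaybeRel.nothing      v≤v'                         = v≤v'
⋌-mono (MaybeRel.just a≤a') MaybeRel.nothing             = MaybeRel.just a≤a'
⋌-mono {just a} {just a'} {just b} {just b'} (MaybeRel.just a≤a') (MaybeRel.just b≤b') =
  MaybeRel.just (graft₁-monoˡ-≤T (a ∨̲ leaf) b≤b' ◅◅ graft₁-monoʳ-≤T b' (∨̲-monoˡ-≤T leaf a≤a'))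

-- Enumerating trees and basis elements

height : Tree → ℕ
height leaf    = 0
height (a ∨̲ b) = suc (height a ℕ.⊔ height b)

height<leaves : ∀ t → height t < leaves t
height<leaves leaf    = s≤s z≤n
height<leaves (a ∨̲ b) = ℕ.≤-trans (s≤s (s≤s (ℕ.m⊔n≤m+n (height a) (height b))))
  (subst (ℕ._≤ leaves a ℕ.+ leaves b) (ℕ.+-suc (suc (height a)) (height b))
         (ℕ.+-mono-≤ (height<leaves a) (height<leaves b)))

𝟙-≟-∨̲ : ∀ p q a b → 𝟙 ((p ∨̲ q) ≟T (a ∨̲ b)) ≡ 𝟙 (p ≟T a) * 𝟙 (q ≟T b)
𝟙-≟-∨̲ p q a b =
  trans (𝟙-⇔ ((p ∨̲ q) ≟T (a ∨̲ b)) ((p ≟T a) ×-dec (q ≟T b))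
             (mk⇔ (λ e → ∨̲-injˡ e , ∨̲-injʳ e) (λ (e , e') → cong₂ _∨̲_ e e')))
        (sym (𝟙-× (p ≟T a) (q ≟T b)))

multiplicity-∨̲ : ∀ h p q → multiplicity _≟T_ (p ∨̲ q) (treesOfHeight≤ (suc h)) ≡
                           multiplicity _≟T_ p (treesOfHeight≤ h) * multiplicity _≟T_ q (treesOfHeight≤ h)
multiplicity-∨̲ h p q = begin
  0ℤ + ∑ (concatMap (λ a → map (a ∨̲_) Tₕ) Tₕ) (λ x → 𝟙 ((p ∨̲ q) ≟T x))
    ≡⟨ trans (+-identityˡ _) (∑-concatMap (λ a → map (a ∨̲_) Tₕ) Tₕ _) ⟩
  ∑ Tₕ (λ a → ∑ (map (a ∨̲_) Tₕ) (λ x → 𝟙 ((p ∨̲ q) ≟T x)))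
    ≡⟨ ∑-cong Tₕ (λ a → trans (∑-map (a ∨̲_) Tₕ _) (∑-cong Tₕ (𝟙-≟-∨̲ p q a))) ⟩
  ∑ Tₕ (λ a → ∑ Tₕ (λ b → 𝟙 (p ≟T a) * 𝟙 (q ≟T b)))
    ≡⟨ ∑-cong Tₕ (λ a → sym (*-distribˡ-∑ (𝟙 (p ≟T a)) Tₕ _)) ⟩
  ∑ Tₕ (λ a → 𝟙 (p ≟T a) * multiplicity _≟T_ q Tₕ)
    ≡⟨ sym (*-distribʳ-∑ _ Tₕ _) ⟩
  multiplicity _≟T_ p Tₕ * multiplicity _≟T_ q Tₕ ∎
  where
  open ≡-Reasoning
  Tₕ : List Tree
  Tₕ = treesOfHeight≤ h

multiplicity-treesOfHeight≤ : ∀ h t → multiplicity _≟T_ t (treesOfHeight≤ h) ≡ 𝟙 (height t ℕ.≤? h)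
multiplicity-treesOfHeight≤ zero    leaf      = refl
multiplicity-treesOfHeight≤ (suc h) leaf      =
  cong (1ℤ +_) (trans (∑-concatMap (λ a → map (a ∨̲_) Tₕ) Tₕ _)
                      (∑-zero Tₕ (λ a → trans (∑-map (a ∨̲_) Tₕ _) (∑-zero Tₕ (λ _ → refl)))))
  where
  Tₕ : List Tree
  Tₕ = treesOfHeight≤ h
multiplicity-treesOfHeight≤ zero    (p ∨̲ q) = refl
multiplicity-treesOfHeight≤ (suc h) (p ∨̲ q) = begin
  multiplicity _≟T_ (p ∨̲ q) (treesOfHeight≤ (suc h))
    ≡⟨ multiplicity-∨̲ h p q ⟩
  multiplicity _≟T_ p (treesOfHeight≤ h) * multiplicity _≟T_ q (treesOfHeight≤ h)
    ≡⟨ cong₂ _*_ (multiplicity-treesOfHeight≤ h p) (multiplicity-treesOfHeight≤ h q) ⟩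
  𝟙 (height p ℕ.≤? h) * 𝟙 (height q ℕ.≤? h)
    ≡⟨ 𝟙-× (height p ℕ.≤? h) (height q ℕ.≤? h) ⟩
  𝟙 ((height p ℕ.≤? h) ×-dec (height q ℕ.≤? h))
    ≡⟨ 𝟙-⇔ ((height p ℕ.≤? h) ×-dec (height q ℕ.≤? h)) (height (p ∨̲ q) ℕ.≤? suc h)
           (mk⇔ (λ (hp , hq) → s≤s (ℕ.⊔-lub hp hq)) components) ⟩
  𝟙 (height (p ∨̲ q) ℕ.≤? suc h) ∎
  where
  open ≡-Reasoning
  components : height (p ∨̲ q) ≤ suc h → height p ≤ h × height q ≤ h
  components (s≤s h⊔) =
    ℕ.≤-trans (ℕ.m≤m⊔n (height p) (height q)) h⊔ , ℕ.≤-trans (ℕ.m≤n⊔m (height p) (height q)) h⊔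

multiplicity-PBT : ∀ n t → multiplicity _≟T_ t (PBT n) ≡ 𝟙 (leaves t ℕ.≟ n)
multiplicity-PBT n t = begin
  multiplicity _≟T_ t (PBT n)
    ≡⟨ ∑-filter (λ x → leaves x ℕ.≟ n) Tₙ _ ⟩
  ∑ Tₙ (λ x → 𝟙 (leaves x ℕ.≟ n) * 𝟙 (t ≟T x))
    ≡⟨ ∑-supported _≟T_ Tₙ t _ (λ x x≢t → trans (cong (𝟙 (leaves x ℕ.≟ n) *_) (𝟙-no (t ≟T x) (x≢t ∘ sym)))
                                                (*-zeroʳ (𝟙 (leaves x ℕ.≟ n)))) ⟩
  multiplicity _≟T_ t Tₙ * (𝟙 (leaves t ℕ.≟ n) * 𝟙 (t ≟T t))
    ≡⟨ cong₂ (λ m i → m * (𝟙 (leaves t ℕ.≟ n) * i)) (multiplicity-treesOfHeight≤ n t) (𝟙-yes (t ≟T t) refl) ⟩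
  𝟙 (height t ℕ.≤? n) * (𝟙 (leaves t ℕ.≟ n) * 1ℤ)
    ≡⟨ cong (𝟙 (height t ℕ.≤? n) *_) (*-identityʳ _) ⟩
  𝟙 (height t ℕ.≤? n) * 𝟙 (leaves t ℕ.≟ n)
    ≡⟨ height-irrelevant (leaves t ℕ.≟ n) ⟩
  𝟙 (leaves t ℕ.≟ n) ∎
  where
  open ≡-Reasoning
  Tₙ : List Tree
  Tₙ = treesOfHeight≤ n
  height-irrelevant : (e : Dec (leaves t ≡ n)) → 𝟙 (height t ℕ.≤? n) * 𝟙 e ≡ 𝟙 e
  height-irrelevant (yes refl) = cong (_* 1ℤ) (𝟙-yes (height t ℕ.≤? n) (ℕ.<⇒≤ (height<leaves t)))
  height-irrelevant (no _)     = *-zeroʳ (𝟙 (height t ℕ.≤? n))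

∈-PBT : ∀ t → t ∈ PBT (leaves t)
∈-PBT t = multiplicity≢0⇒∈ _≟T_ t (PBT (leaves t)) (λ m≡0 → one≢zero (trans (sym once) m≡0))
  where
  once : multiplicity _≟T_ t (PBT (leaves t)) ≡ 1ℤ
  once = trans (multiplicity-PBT (leaves t) t) (𝟙-yes (leaves t ℕ.≟ leaves t) refl)
  one≢zero : 1ℤ ≢ 0ℤ
  one≢zero ()

basisOfDegree : ℕ → List Basis
basisOfDegree zero    = nothing ∷ []
basisOfDegree (suc n) = map just (PBT (suc n))

multiplicity-map-just : ∀ a ts → multiplicity _≟B_ (just a) (map just ts) ≡ multiplicity _≟T_ a ts
multiplicity-map-just a ts =
  trans (∑-map just ts _) (∑-cong ts (λ x → 𝟙-⇔ (just a ≟B just x) (a ≟T x) (mk⇔ just-injective (cong just))))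

multiplicity-basisOfDegree : ∀ x p → multiplicity _≟B_ x (basisOfDegree p) ≡ 𝟙 (deg x ℕ.≟ p)
multiplicity-basisOfDegree nothing  zero    = refl
multiplicity-basisOfDegree nothing  (suc p) = trans (∑-map just (PBT (suc p)) _) (∑-zero (PBT (suc p)) (λ _ → refl))
multiplicity-basisOfDegree (just a) zero    = sym (𝟙-no (leaves a ℕ.≟ 0) (ℕ.<⇒≢ (0<leaves a) ∘ sym))
multiplicity-basisOfDegree (just a) (suc p) = trans (multiplicity-map-just a (PBT (suc p))) (multiplicity-PBT (suc p) a)

𝟙-≤-suc : ∀ m n → 𝟙 (m ℕ.≤? n) + 𝟙 (m ℕ.≟ suc n) ≡ 𝟙 (m ℕ.≤? suc n)
𝟙-≤-suc m n = cases (m ℕ.≤? n) (m ℕ.≟ suc n)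
  where
  cases : (m≤?n : Dec (m ≤ n)) (m≟1+n : Dec (m ≡ suc n)) → 𝟙 m≤?n + 𝟙 m≟1+n ≡ 𝟙 (m ℕ.≤? suc n)
  cases (yes m≤n) (yes refl) = ⊥-elim (ℕ.<-irrefl refl m≤n)
  cases (yes m≤n) (no _)     = sym (𝟙-yes (m ℕ.≤? suc n) (ℕ.m≤n⇒m≤1+n m≤n))
  cases (no _)    (yes refl) = sym (𝟙-yes (m ℕ.≤? suc n) ℕ.≤-refl)
  cases (no m≰n)  (no m≢1+n) = sym (𝟙-no (m ℕ.≤? suc n) (λ m≤1+n → m≰n (ℕ.≤-pred (ℕ.≤∧≢⇒< m≤1+n m≢1+n))))

multiplicity-basis≤ : ∀ n x → multiplicity _≟B_ x (basis≤ n) ≡ 𝟙 (deg x ℕ.≤? n)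
multiplicity-basis≤ zero    x = trans (multiplicity-basisOfDegree x 0)
                                      (𝟙-⇔ (deg x ℕ.≟ 0) (deg x ℕ.≤? 0) (mk⇔ ℕ.≤-reflexive ℕ.n≤0⇒n≡0))
multiplicity-basis≤ (suc n) x = begin
  multiplicity _≟B_ x (basis≤ n ++ basisOfDegree (suc n))
    ≡⟨ ∑-++ (basis≤ n) (basisOfDegree (suc n)) _ ⟩
  multiplicity _≟B_ x (basis≤ n) + multiplicity _≟B_ x (basisOfDegree (suc n))
    ≡⟨ cong₂ _+_ (multiplicity-basis≤ n x) (multiplicity-basisOfDegree x (suc n)) ⟩
  𝟙 (deg x ℕ.≤? n) + 𝟙 (deg x ℕ.≟ suc n)
    ≡⟨ 𝟙-≤-suc (deg x) n ⟩
  𝟙 (deg x ℕ.≤? suc n) ∎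
  where open ≡-Reasoning

⋌-factors-listed : ∀ {u v t} → u ⋌ v ≡ just t →
                   multiplicity _≟B_ u (basis≤ (leaves t)) ≡ 1ℤ × multiplicity _≟B_ v (basis≤ (leaves t)) ≡ 1ℤ
⋌-factors-listed {u} {v} {t} u⋌v≡t = listed u (ℕ.m≤m+n (deg u) (deg v)) , listed v (ℕ.m≤n+m (deg v) (deg u))
  where
  degrees : deg u ℕ.+ deg v ≡ leaves t
  degrees = trans (sym (⋌-deg u v)) (cong deg u⋌v≡t)
  listed : ∀ z → deg z ≤ deg u ℕ.+ deg v → multiplicity _≟B_ z (basis≤ (leaves t)) ≡ 1ℤ
  listed z z≤ = trans (multiplicity-basis≤ (leaves t) z) (𝟙-yes (deg z ℕ.≤? leaves t) (subst (deg z ≤_) degrees z≤))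

-- Cutting a tree between two leaves

extendʳ : Tree → Basis × Basis → Basis × Basis
extendʳ r (x , y) = x , y ∨̲B just r

extendˡ : Tree → Basis × Basis → Basis × Basis
extendˡ l (x , y) = just l ∨̲B x , y

-- split k w cuts w along the path from the root to the gap after its k-th
-- leaf; ⊛Δ(w) is the sum of these cuts (Δtree-pairing).
split : ℕ → Tree → Basis × Basis
split k       (l ∨̲ r) with k ℕ.≤? leaves l
... | yes _ = extendʳ r (split k l)
... | no  _ = extendˡ l (split (k ∸ leaves l) r)
split zero    leaf    = nothing , just leaf
split (suc _) leaf    = just leaf , nothing

split-∨̲ˡ : ∀ {k} l r → k ≤ leaves l → split k (l ∨̲ r) ≡ extendʳ r (split k l)
split-∨̲ˡ {k} l r k≤l with k ℕ.≤? leaves l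
... | yes _   = refl
... | no  k≰l = ⊥-elim (k≰l k≤l)

split-∨̲ʳ : ∀ {k} l r → ¬ k ≤ leaves l → split k (l ∨̲ r) ≡ extendˡ l (split (k ∸ leaves l) r)
split-∨̲ʳ {k} l r k≰l with k ℕ.≤? leaves l
... | yes k≤l = ⊥-elim (k≰l k≤l)
... | no  _   = refl

split-∨̲-shift : ∀ l r j → split (suc (leaves l) ℕ.+ j) (l ∨̲ r) ≡ extendˡ l (split (suc j) r)
split-∨̲-shift l r j = begin
  split (suc (leaves l) ℕ.+ j) (l ∨̲ r)
    ≡⟨ cong (λ k → split k (l ∨̲ r)) (ℕ.+-suc (leaves l) j) ⟨
  split (leaves l ℕ.+ suc j) (l ∨̲ r)
    ≡⟨ split-∨̲ʳ l r (ℕ.m+1+n≰m (leaves l)) ⟩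
  extendˡ l (split (leaves l ℕ.+ suc j ∸ leaves l) r)
    ≡⟨ cong (λ k → extendˡ l (split k r)) (ℕ.m+n∸m≡n (leaves l) (suc j)) ⟩
  extendˡ l (split (suc j) r) ∎
  where open ≡-Reasoning

split-zero : ∀ t → split 0 t ≡ (nothing , just t)
split-zero leaf    = refl
split-zero (l ∨̲ r) rewrite split-∨̲ˡ l r z≤n | split-zero l = refl

split-leaves : ∀ t → split (leaves t) t ≡ (just t , nothing)
split-leaves leaf    = refl
split-leaves (l ∨̲ r)
  rewrite split-∨̲ʳ l r (ℕ.m+1+n≰m (leaves l) ∘ ℕ.≤-trans (ℕ.+-monoʳ-≤ (leaves l) (0<leaves r)))
        | ℕ.m+n∸m≡n (leaves l) (leaves r) | split-leaves r = refl

split-⋌ : ∀ u v {w} → u ⋌ v ≡ just w → split (deg u) w ≡ (u , v)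
split-⋌ nothing  v        refl = split-zero _
split-⋌ (just a) nothing  refl = split-leaves a
split-⋌ (just a) (just b) refl = split-graft₁ b
  where
  leaves<leaves-graft₁ : ∀ b → leaves a < leaves (graft₁ b (a ∨̲ leaf))
  leaves<leaves-graft₁ leaf      = ℕ.m<m+n (leaves a) (s≤s z≤n)
  leaves<leaves-graft₁ (b₁ ∨̲ b₂) = ℕ.<-≤-trans (leaves<leaves-graft₁ b₁) (ℕ.m≤m+n _ _)
  split-graft₁ : ∀ b → split (leaves a) (graft₁ b (a ∨̲ leaf)) ≡ (just a , just b)
  split-graft₁ leaf rewrite split-∨̲ˡ a leaf ℕ.≤-refl | split-leaves a = refl
  split-graft₁ (b₁ ∨̲ b₂)
    rewrite split-∨̲ˡ (graft₁ b₁ (a ∨̲ leaf)) b₂ (ℕ.<⇒≤ (leaves<leaves-graft₁ b₁)) | split-graft₁ b₁ = refl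

deg-∨̲B : ∀ l x → deg (just l ∨̲B x) ≡ leaves l ℕ.+ deg x
deg-∨̲B l nothing  = sym (ℕ.+-identityʳ (leaves l))
deg-∨̲B l (just _) = refl

deg-split : ∀ k w → k ≤ leaves w → deg (proj₁ (split k w)) ≡ k
deg-split zero          leaf    _ = refl
deg-split (suc zero)    leaf    _ = refl
deg-split (suc (suc _)) leaf    (s≤s ())
deg-split k             (l ∨̲ r) k≤w with k ℕ.≤? leaves l
... | yes k≤l = deg-split k l k≤l
... | no  k≰l = trans (deg-∨̲B l (proj₁ (split (k ∸ leaves l) r)))
                      (trans (cong (leaves l ℕ.+_) (deg-split (k ∸ leaves l) r (ℕ.m≤n+o⇒m∸n≤o k (leaves l) k≤w)))
                             (ℕ.m+[n∸m]≡n (ℕ.<⇒≤ (ℕ.≰⇒> k≰l))))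

split-⋌-≤ : ∀ k w → proj₁ (split k w) ⋌ proj₂ (split k w) ≤B just w
split-⋌-≤ zero    leaf    = MaybeRel.just ε
split-⋌-≤ (suc k) leaf    = MaybeRel.just ε
split-⋌-≤ k       (l ∨̲ r) with k ℕ.≤? leaves l
... | yes _ = left-part (split k l) (split-⋌-≤ k l)
  where
  left-part : ∀ X → proj₁ X ⋌ proj₂ X ≤B just l → proj₁ (extendʳ r X) ⋌ proj₂ (extendʳ r X) ≤B just (l ∨̲ r)
  left-part (nothing , just y) (MaybeRel.just y≤l) = MaybeRel.just (∨̲-monoˡ-≤T r y≤l)
  left-part (just x  , nothing) (MaybeRel.just x≤l) = MaybeRel.just (graft₁-∨̲leaf-≤T r x ◅◅ ∨̲-monoˡ-≤T r x≤l)
  left-part (just x  , just y) (MaybeRel.just g≤l) = MaybeRel.just (∨̲-monoˡ-≤T r g≤l)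
... | no _ = right-part (split (k ∸ leaves l) r) (split-⋌-≤ (k ∸ leaves l) r)
  where
  right-part : ∀ X → proj₁ X ⋌ proj₂ X ≤B just r → proj₁ (extendˡ l X) ⋌ proj₂ (extendˡ l X) ≤B just (l ∨̲ r)
  right-part (nothing , just y) (MaybeRel.just y≤r) = MaybeRel.just (graft₁-∨̲leaf-≤T y l ◅◅ ∨̲-monoʳ-≤T l y≤r)
  right-part (just x  , nothing) (MaybeRel.just x≤r) = MaybeRel.just (∨̲-monoʳ-≤T l x≤r)
  right-part (just x  , just y) (MaybeRel.just g≤r) =
    MaybeRel.just (graft₁-monoʳ-≤T y rotation ◅◅ graft₁-∨̲-≤T y l (x ∨̲ leaf) ◅◅ ∨̲-monoʳ-≤T l g≤r)

infix 4 _≤B²_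
_≤B²_ : Rel (Basis × Basis) 0ℓ
_≤B²_ = ×Rel.Pointwise _≤B_ _≤B_

≤B²-refl : ∀ {X} → X ≤B² X
≤B²-refl = ≤B-refl , ≤B-refl

≤B²-trans : ∀ {X Y Z} → X ≤B² Y → Y ≤B² Z → X ≤B² Z
≤B²-trans (x≤y , x≤y') (y≤z , y≤z') = ≤B-trans x≤y y≤z , ≤B-trans x≤y' y≤z'

extendʳ-monoʳ : ∀ r {X Y} → X ≤B² Y → extendʳ r X ≤B² extendʳ r Y
extendʳ-monoʳ r {_ , nothing} (x≤x' , MaybeRel.nothing) = x≤x' , ≤B-refl
extendʳ-monoʳ r {_ , just _}  (x≤x' , MaybeRel.just y≤y') = x≤x' , MaybeRel.just (∨̲-monoˡ-≤T r y≤y')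

extendˡ-monoʳ : ∀ l {X Y} → X ≤B² Y → extendˡ l X ≤B² extendˡ l Y
extendˡ-monoʳ l {nothing , _} (MaybeRel.nothing , y≤y')    = ≤B-refl , y≤y'
extendˡ-monoʳ l {just _ , _}  (MaybeRel.just x≤x' , y≤y') = MaybeRel.just (∨̲-monoʳ-≤T l x≤x') , y≤y'

extendʳ-monoˡ : ∀ {r r'} X → r ≤T r' → extendʳ r X ≤B² extendʳ r' X
extendʳ-monoˡ (x , nothing) r≤r' = ≤B-refl , MaybeRel.just r≤r'
extendʳ-monoˡ (x , just y)  r≤r' = ≤B-refl , MaybeRel.just (∨̲-monoʳ-≤T y r≤r')

extendˡ-monoˡ : ∀ {l l'} X → l ≤T l' → extendˡ l X ≤B² extendˡ l' X
extendˡ-monoˡ (nothing , y) l≤l' = MaybeRel.just l≤l' , ≤B-refl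
extendˡ-monoˡ (just x , y)  l≤l' = MaybeRel.just (∨̲-monoˡ-≤T x l≤l') , ≤B-refl

split-monoˡ : ∀ {a a'} b → leaves a ≡ leaves a' → a ≤T a' → (∀ k → split k a ≤B² split k a') →
              ∀ k → split k (a ∨̲ b) ≤B² split k (a' ∨̲ b)
split-monoˡ {a} {a'} b la≡la' a≤a' split-a≤ k with k ℕ.≤? leaves a
... | yes k≤a rewrite split-∨̲ˡ a' b (subst (k ≤_) la≡la' k≤a) = extendʳ-monoʳ b (split-a≤ k)
... | no  k≰a rewrite split-∨̲ʳ a' b (k≰a ∘ subst (k ≤_) (sym la≡la')) | sym la≡la' =
  extendˡ-monoˡ (split (k ∸ leaves a) b) a≤a'

split-monoʳ : ∀ a {b b'} → b ≤T b' → (∀ k → split k b ≤B² split k b') →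
              ∀ k → split k (a ∨̲ b) ≤B² split k (a ∨̲ b')
split-monoʳ a b≤b' split-b≤ k with k ℕ.≤? leaves a
... | yes _ = extendʳ-monoˡ (split k a) b≤b'
... | no  _ = extendˡ-monoʳ a (split-b≤ (k ∸ leaves a))

split-rotation : ∀ a b c k → split k ((a ∨̲ b) ∨̲ c) ≤B² split k (a ∨̲ (b ∨̲ c))
split-rotation a b c k with k ℕ.≤? leaves a | k ℕ.≤? leaves a ℕ.+ leaves b
... | yes k≤a | yes k≤ab rewrite split-∨̲ˡ a b k≤a = cut-in-a (split k a)
  where
  cut-in-a : ∀ X → extendʳ c (extendʳ b X) ≤B² extendʳ (b ∨̲ c) X
  cut-in-a (x , nothing) = ≤B²-refl
  cut-in-a (x , just y)  = ≤B-refl , MaybeRel.just rotation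
... | yes k≤a | no  k≰ab = ⊥-elim (k≰ab (ℕ.≤-trans k≤a (ℕ.m≤m+n _ _)))
... | no  k≰a | yes k≤ab
  rewrite split-∨̲ʳ a b k≰a | split-∨̲ˡ b c (ℕ.m≤n+o⇒m∸n≤o k (leaves a) k≤ab) = ≤B²-refl
... | no  k≰a | no  k≰ab
  rewrite split-∨̲ʳ {k ∸ leaves a} b c
            (λ k-a≤b → k≰ab (ℕ.≤-trans (ℕ.m≤n+m∸n k (leaves a)) (ℕ.+-monoʳ-≤ (leaves a) k-a≤b)))
        | ℕ.∸-+-assoc k (leaves a) (leaves b) = cut-in-c (split (k ∸ (leaves a ℕ.+ leaves b)) c)
  where
  cut-in-c : ∀ X → extendˡ (a ∨̲ b) X ≤B² extendˡ a (extendˡ b X)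
  cut-in-c (nothing , y) = ≤B²-refl
  cut-in-c (just x , y)  = MaybeRel.just rotation , ≤B-refl

split-mono : ∀ {w w'} → w ≤T w' → ∀ k → split k w ≤B² split k w'
split-mono ε        k = ≤B²-refl
split-mono (p ◅ ps) k = ≤B²-trans (split-mono-⇒R p k) (split-mono ps k)
  where
  split-mono-⇒R : ∀ {w w'} → w ⇒R w' → ∀ k → split k w ≤B² split k w'
  split-mono-⇒R (rot {a} {b} {c}) = split-rotation a b c
  split-mono-⇒R (left {b = b} p)  = split-monoˡ b (⇒R-leaves p) (p ◅ ε) (split-mono-⇒R p)
  split-mono-⇒R (right {a = a} p) = split-monoʳ a (p ◅ ε) (split-mono-⇒R p)

⋌-split-galois : ∀ u v w → ((u , v) ≤B² split (deg u) w) ⇔ (u ⋌ v ≤B just w)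
⋌-split-galois u v w = mk⇔ (λ (u≤ , v≤) → ≤B-trans (⋌-mono u≤ v≤) (split-⋌-≤ (deg u) w)) (from (u ⋌ v) refl)
  where
  from : ∀ z → u ⋌ v ≡ z → z ≤B just w → (u , v) ≤B² split (deg u) w
  from (just p) u⋌v≡p (MaybeRel.just p≤w) = subst (_≤B² split (deg u) w) (split-⋌ u v u⋌v≡p) (split-mono p≤w (deg u))

-- Pairings

⟨_,_⟩ : H → (Basis → ℤ) → ℤ
⟨ U , f ⟩ = ∑ U (λ (c , x) → c * f x)

⟪_,_⟫ : H⊗H → (Basis → Basis → ℤ) → ℤ
⟪ X , φ ⟫ = ∑ X (λ (c , a , b) → c * φ a b)

_⊠_ : (Basis → ℤ) → (Basis → ℤ) → Basis → Basis → ℤ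
(f ⊠ g) a b = f a * g b

⊗-pairing : ∀ U V f g → ⟪ U ⊗ V , f ⊠ g ⟫ ≡ ⟨ U , f ⟩ * ⟨ V , g ⟩
⊗-pairing U V f g = begin
  ⟪ U ⊗ V , f ⊠ g ⟫
    ≡⟨ ∑-concatMap _ U _ ⟩
  ∑ U (λ (c , a) → ∑ (map (λ (d , b) → (c * d , a , b)) V) (λ (e , a , b) → e * (f a * g b)))
    ≡⟨ ∑-cong U (λ (c , a) → trans (∑-map _ V _) (∑-cong V (λ (d , b) → regroup c d (f a) (g b)))) ⟩
  ∑ U (λ (c , a) → ∑ V (λ (d , b) → (c * f a) * (d * g b)))
    ≡⟨ ∑-cong U (λ (c , a) → sym (*-distribˡ-∑ (c * f a) V _)) ⟩
  ∑ U (λ (c , a) → (c * f a) * ⟨ V , g ⟩)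
    ≡⟨ sym (*-distribʳ-∑ ⟨ V , g ⟩ U _) ⟩
  ⟨ U , f ⟩ * ⟨ V , g ⟩ ∎
  where
  open ≡-Reasoning
  regroup : ∀ c d x y → (c * d) * (x * y) ≡ (c * x) * (d * y)
  regroup = solve-∀

Δ-pairing : ∀ U φ → ⟪ Δ U , φ ⟫ ≡ ⟨ U , (λ x → ⟪ ΔB x , φ ⟫) ⟩
Δ-pairing U φ = trans (∑-concatMap _ U _) (∑-cong U (λ (c , x) →
  trans (∑-map _ (ΔB x) _)
        (trans (∑-cong (ΔB x) (λ (d , a , b) → *-assoc c d (φ a b))) (sym (*-distribˡ-∑ c (ΔB x) _)))))

Δtree-pairing : ∀ w φ → ⟪ Δtree w , φ ⟫ ≡ ∑< (suc (leaves w)) (λ j → uncurry φ (split j w))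
Δtree-pairing leaf    φ =
  cong₂ _+_ (*-identityˡ (φ nothing (just leaf))) (cong (_+ 0ℤ) (*-identityˡ (φ (just leaf) nothing)))
Δtree-pairing (l ∨̲ r) φ = begin
  ⟪ Δtree (l ∨̲ r) , φ ⟫
    ≡⟨ trans (∑-++ (map cutˡ (Δtree l)) _ _) (cong (⟪ map cutˡ (Δtree l) , φ ⟫ +_) (∑-++ (map cutʳ (Δtree r)) _ _)) ⟩
  ⟪ map cutˡ (Δtree l) , φ ⟫ + (⟪ map cutʳ (Δtree r) , φ ⟫ + (- 1ℤ * φ (just l) (just r) + 0ℤ))
    ≡⟨ cong₂ (λ x y → x + (y + (- 1ℤ * φ (just l) (just r) + 0ℤ))) left-cuts right-cuts ⟩
  ∑< (suc (leaves l)) F + ((φ (just l) (just r) + ∑< (leaves r) F⁺) + (- 1ℤ * φ (just l) (just r) + 0ℤ))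
    ≡⟨ cancel (∑< (suc (leaves l)) F) (∑< (leaves r) F⁺) (φ (just l) (just r)) ⟩
  ∑< (suc (leaves l)) F + ∑< (leaves r) F⁺
    ≡⟨ ∑<-+ (suc (leaves l)) (leaves r) F ⟨
  ∑< (suc (leaves l ℕ.+ leaves r)) F ∎
  where
  open ≡-Reasoning
  cutˡ : ℤ × Basis × Basis → ℤ × Basis × Basis
  cutˡ (c , a , b) = c , a , b ∨̲B just r
  cutʳ : ℤ × Basis × Basis → ℤ × Basis × Basis
  cutʳ (c , a , b) = c , just l ∨̲B a , b
  F : ℕ → ℤ
  F j = uncurry φ (split j (l ∨̲ r))
  F⁺ : ℕ → ℤ
  F⁺ j = F (suc (leaves l) ℕ.+ j)
  cancel : ∀ a b c → a + ((c + b) + (- 1ℤ * c + 0ℤ)) ≡ a + b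
  cancel = solve-∀
  left-cuts : ⟪ map cutˡ (Δtree l) , φ ⟫ ≡ ∑< (suc (leaves l)) F
  left-cuts = begin
    ⟪ map cutˡ (Δtree l) , φ ⟫
      ≡⟨ ∑-map cutˡ (Δtree l) _ ⟩
    ⟪ Δtree l , (λ a b → φ a (b ∨̲B just r)) ⟫
      ≡⟨ Δtree-pairing l (λ a b → φ a (b ∨̲B just r)) ⟩
    ∑< (suc (leaves l)) (λ j → uncurry φ (extendʳ r (split j l)))
      ≡⟨ ∑<-cong (suc (leaves l)) (λ j j<1+l → cong (uncurry φ) (sym (split-∨̲ˡ l r (ℕ.≤-pred j<1+l)))) ⟩
    ∑< (suc (leaves l)) F ∎
  right-cuts : ⟪ map cutʳ (Δtree r) , φ ⟫ ≡ φ (just l) (just r) + ∑< (leaves r) F⁺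
  right-cuts = begin
    ⟪ map cutʳ (Δtree r) , φ ⟫
      ≡⟨ ∑-map cutʳ (Δtree r) _ ⟩
    ⟪ Δtree r , (λ a b → φ (just l ∨̲B a) b) ⟫
      ≡⟨ Δtree-pairing r (λ a b → φ (just l ∨̲B a) b) ⟩
    uncurry φ (extendˡ l (split 0 r)) + ∑< (leaves r) (λ j → uncurry φ (extendˡ l (split (suc j) r)))
      ≡⟨ cong₂ _+_ (cong (uncurry φ ∘ extendˡ l) (split-zero r))
                   (∑<-cong (leaves r) (λ j _ → cong (uncurry φ) (sym (split-∨̲-shift l r j)))) ⟩
    φ (just l) (just r) + ∑< (leaves r) F⁺ ∎

coeff-∷ : ∀ c a b X x y → coeff ((c , a , b) ∷ X) x y ≡ c * 𝟙 (a ≟B x) * 𝟙 (b ≟B y) + coeff X x y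
coeff-∷ c a b X x y with a ≟B x | b ≟B y
... | yes _ | yes _ = cong (_+ coeff X x y) (sym (trans (*-identityʳ (c * 1ℤ)) (*-identityʳ c)))
... | yes _ | no  _ = sym (trans (cong (_+ coeff X x y) (*-zeroʳ (c * 1ℤ))) (+-identityˡ _))
... | no  _ | yes _ = sym (trans (cong (λ m → m * 1ℤ + coeff X x y) (*-zeroʳ c)) (+-identityˡ _))
... | no  _ | no  _ = sym (trans (cong (λ m → m * 0ℤ + coeff X x y) (*-zeroʳ c)) (+-identityˡ _))

module Zeta (_≤?_ : Decidable _≤T_) where

  open MBasis _≤?_

  infix 4 _≤B?_
  _≤B?_ : Decidable _≤B_
  _≤B?_ = MaybeRel.dec _≤?_

  ζ : Basis → Basis → ℤ
  ζ x y = 𝟙 (x ≤B? y)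

  ζ-deg : ∀ x y → deg x ≢ deg y → ζ x y ≡ 0ℤ
  ζ-deg x y dx≢dy = 𝟙-no (x ≤B? y) (dx≢dy ∘ ≤B-deg)

  sumℤ-map : ∀ {A : Set} (xs : List A) (f : A → ℤ) → sumℤ (map f xs) ≡ ∑ xs f
  sumℤ-map []       f = refl
  sumℤ-map (x ∷ xs) f = cong (f x +_) (sumℤ-map xs f)

  -- Verbatim the filter predicate of mobF, so that mobF unfolds to filters by it.
  between : (w t z : Tree) → Dec (T (⌊ w ≤? z ⌋ ∧ ⌊ z ≤? t ⌋ ∧ not ⌊ z ≟T w ⌋))
  between w t z = T? (⌊ w ≤? z ⌋ ∧ ⌊ z ≤? t ⌋ ∧ not ⌊ z ≟T w ⌋)

  between-spec : ∀ {w t z} → T (⌊ w ≤? z ⌋ ∧ ⌊ z ≤? t ⌋ ∧ not ⌊ z ≟T w ⌋) → w ≤T z × z ≤T t × z ≢ w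
  between-spec {w} {t} {z} h with w ≤? z | z ≤? t | z ≟T w
  ... | yes w≤z | yes z≤t | no z≢w = w≤z , z≤t , z≢w

  mobF-diag : ∀ k t → mobF (suc k) t t ≡ 1ℤ
  mobF-diag k t with t ≟T t
  ... | yes _   = refl
  ... | no  t≢t = ⊥-elim (t≢t refl)

  mobF-≰ : ∀ k w t → ¬ w ≤T t → mobF (suc k) w t ≡ 0ℤ
  mobF-≰ k w t w≰t with w ≟T t
  ... | yes refl = ⊥-elim (w≰t ε)
  ... | no _ with w ≤? t
  ...   | yes w≤t = ⊥-elim (w≰t w≤t)
  ...   | no _    = refl

  mobF-< : ∀ k w t → w ≢ t → w ≤T t →
           mobF (suc k) w t ≡ - sumℤ (map (λ z → mobF k z t) (filter (between w t) (PBT (leaves t))))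
  mobF-< k w t w≢t w≤t with w ≟T t
  ... | yes w≡t = ⊥-elim (w≢t w≡t)
  ... | no _ with w ≤? t
  ...   | yes _   = refl
  ...   | no  w≰t = ⊥-elim (w≰t w≤t)

  μ-diag : ∀ t → μ t t ≡ 1ℤ
  μ-diag t = mobF-diag _ t

  μ-≰ : ∀ w t → ¬ w ≤T t → μ w t ≡ 0ℤ
  μ-≰ w t = mobF-≰ _ w t

  -- The fuel |PBT n| + 1 of μ suffices because it exceeds the size of every
  -- interval [z , t], which strictly shrinks along the recursion.
  module _ (t : Tree) where

    intervalSize : Tree → ℕ
    intervalSize z = length (filter (λ y → (z ≤? y) ×-dec (y ≤? t)) (PBT (leaves t)))

    intervalSize-< : ∀ {z z'} → leaves z ≡ leaves t → z ≤T z' → z' ≢ z → z ≤T t →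
                     intervalSize z' < intervalSize z
    intervalSize-< {z} {z'} z∈PBTₙ z≤z' z'≢z z≤t =
      length-filter-strict (λ y → (z' ≤? y) ×-dec (y ≤? t)) (λ y → (z ≤? y) ×-dec (y ≤? t))
        (λ (z'≤y , y≤t) → z≤z' ◅◅ z'≤y , y≤t)
        (subst (λ m → z ∈ PBT m) z∈PBTₙ (∈-PBT z)) (ε , z≤t) (λ (z'≤z , _) → z'≢z (≤T-antisym z'≤z z≤z'))

    mobF-stable : ∀ k j z → leaves z ≡ leaves t → intervalSize z < k → mobF k z t ≡ mobF (k ℕ.+ j) z t
    mobF-stable (suc k) j z lz≡lt size<k with z ≟T t
    ... | yes _ = refl
    ... | no _ with z ≤? t
    ...   | no  _   = refl
    ...   | yes z≤t = cong (λ xs → - sumℤ xs) (map-cong-local (All.tabulate stable))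
      where
      stable : ∀ {z'} → z' ∈ filter (between z t) (PBT (leaves t)) → mobF k z' t ≡ mobF (k ℕ.+ j) z' t
      stable {z'} z'∈I with between-spec (proj₂ (∈-filter⁻ (between z t) {xs = PBT (leaves t)} z'∈I))
      ... | z≤z' , z'≤t , z'≢z =
        mobF-stable k j z' (≤T-leaves z'≤t) (ℕ.<-≤-trans (intervalSize-< lz≡lt z≤z' z'≢z z≤t) (ℕ.≤-pred size<k))

    μ-< : ∀ a → a ≢ t → a ≤T t → μ a t ≡ - ∑ (filter (between a t) (PBT (leaves t))) (λ z → μ z t)
    μ-< a a≢t a≤t = begin
      μ a t
        ≡⟨ mobF-< N a t a≢t a≤t ⟩
      - sumℤ (map (λ z → mobF N z t) I)
        ≡⟨ cong (λ xs → - sumℤ xs) (map-cong-local (All.tabulate enough-fuel)) ⟩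
      - sumℤ (map (λ z → μ z t) I)
        ≡⟨ cong -_ (sumℤ-map I (λ z → μ z t)) ⟩
      - ∑ I (λ z → μ z t) ∎
      where
      open ≡-Reasoning
      N : ℕ
      N = length (PBT (leaves t))
      I : List Tree
      I = filter (between a t) (PBT (leaves t))
      enough-fuel : ∀ {z} → z ∈ I → mobF N z t ≡ μ z t
      enough-fuel {z} z∈I with between-spec (proj₂ (∈-filter⁻ (between a t) {xs = PBT (leaves t)} z∈I))
      ... | a≤z , z≤t , z≢a =
        trans (mobF-stable N 1 z (≤T-leaves z≤t)
                 (ℕ.<-≤-trans (intervalSize-< (≤T-leaves a≤t) a≤z z≢a a≤t) (length-filter _ (PBT (leaves t)))))
              (cong (λ k → mobF k z t) (ℕ.+-comm N 1))

  möbius-inversion-diag : ∀ t → ∑ (PBT (leaves t)) (λ w → μ w t * 𝟙 (t ≤? w)) ≡ 1ℤ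
  möbius-inversion-diag t = begin
    ∑ (PBT (leaves t)) (λ w → μ w t * 𝟙 (t ≤? w))
      ≡⟨ ∑-supported _≟T_ (PBT (leaves t)) t _ off-diagonal ⟩
    multiplicity _≟T_ t (PBT (leaves t)) * (μ t t * 𝟙 (t ≤? t))
      ≡⟨ cong₂ (λ m x → m * (x * 𝟙 (t ≤? t))) (multiplicity-PBT (leaves t) t) (μ-diag t) ⟩
    𝟙 (leaves t ℕ.≟ leaves t) * (1ℤ * 𝟙 (t ≤? t))
      ≡⟨ cong₂ (λ m x → m * (1ℤ * x)) (𝟙-yes (leaves t ℕ.≟ leaves t) refl) (𝟙-yes (t ≤? t) ε) ⟩
    1ℤ ∎
    where
    open ≡-Reasoning
    off-diagonal : ∀ w → w ≢ t → μ w t * 𝟙 (t ≤? w) ≡ 0ℤ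
    off-diagonal w w≢t with t ≤? w
    ... | yes t≤w = trans (cong (_* 1ℤ) (μ-≰ w t (λ w≤t → w≢t (≤T-antisym w≤t t≤w)))) refl
    ... | no  _   = *-zeroʳ (μ w t)

  möbius-inversion-≰ : ∀ a t → ¬ a ≤T t → ∑ (PBT (leaves t)) (λ w → μ w t * 𝟙 (a ≤? w)) ≡ 0ℤ
  möbius-inversion-≰ a t a≰t = ∑-zero (PBT (leaves t)) vanish
    where
    vanish : ∀ w → μ w t * 𝟙 (a ≤? w) ≡ 0ℤ
    vanish w with a ≤? w
    ... | yes a≤w = trans (cong (_* 1ℤ) (μ-≰ w t (λ w≤t → a≰t (a≤w ◅◅ w≤t)))) refl
    ... | no  _   = *-zeroʳ (μ w t)

  μ-split-at : ∀ {a t} → a ≤T t → ∀ w → μ w t * 𝟙 (a ≤? w) ≡ 𝟙 (a ≟T w) * μ w t + 𝟙 (between a t w) * μ w t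
  μ-split-at {a} {t} a≤t w with a ≤? w | w ≤? t | w ≟T a | a ≟T w
  ... | _       | _       | yes refl | no a≢a   = ⊥-elim (a≢a refl)
  ... | _       | _       | no w≢w   | yes refl = ⊥-elim (w≢w refl)
  ... | yes _   | yes _   | yes refl | yes _    = diagonal (μ w t)
    where
    diagonal : ∀ m → m * 1ℤ ≡ 1ℤ * m + 0ℤ * m
    diagonal = solve-∀
  ... | yes _   | yes _   | no _     | no _     = inside (μ w t)
    where
    inside : ∀ m → m * 1ℤ ≡ 0ℤ * m + 1ℤ * m
    inside = solve-∀
  ... | yes _   | no  w≰t | no _     | no _     =
    trans (cong (_* 1ℤ) (μ-≰ w t w≰t)) (sym (cong (λ m → 0ℤ * m + 0ℤ * m) (μ-≰ w t w≰t)))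
  ... | yes _   | no  w≰t | yes refl | yes _    = ⊥-elim (w≰t a≤t)
  ... | no  a≰a | _       | yes refl | yes _    = ⊥-elim (a≰a ε)
  ... | no  _   | _       | no _     | no _     = outside (μ w t)
    where
    outside : ∀ m → m * 0ℤ ≡ 0ℤ * m + 0ℤ * m
    outside = solve-∀

  möbius-inversion-< : ∀ a t → a ≢ t → a ≤T t → ∑ (PBT (leaves t)) (λ w → μ w t * 𝟙 (a ≤? w)) ≡ 0ℤ
  möbius-inversion-< a t a≢t a≤t = begin
    ∑ Pₙ (λ w → μ w t * 𝟙 (a ≤? w))
      ≡⟨ ∑-cong Pₙ (μ-split-at a≤t) ⟩
    ∑ Pₙ (λ w → 𝟙 (a ≟T w) * μ w t + 𝟙 (between a t w) * μ w t)
      ≡⟨ ∑-distrib-+ Pₙ _ _ ⟩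
    ∑ Pₙ (λ w → 𝟙 (a ≟T w) * μ w t) + ∑ Pₙ (λ w → 𝟙 (between a t w) * μ w t)
      ≡⟨ cong₂ _+_ (∑-pick _≟T_ Pₙ a (λ w → μ w t)) (sym (∑-filter (between a t) Pₙ (λ w → μ w t))) ⟩
    multiplicity _≟T_ a Pₙ * μ a t + S
      ≡⟨ cong (λ m → m * μ a t + S)
              (trans (multiplicity-PBT (leaves t) a) (𝟙-yes (leaves a ℕ.≟ leaves t) (≤T-leaves a≤t))) ⟩
    1ℤ * μ a t + S
      ≡⟨ cong (_+ S) (trans (*-identityˡ (μ a t)) (μ-< t a a≢t a≤t)) ⟩
    - S + S
      ≡⟨ +-inverseˡ S ⟩
    0ℤ ∎
    where
    open ≡-Reasoning
    Pₙ : List Tree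
    Pₙ = PBT (leaves t)
    S : ℤ
    S = ∑ (filter (between a t) Pₙ) (λ w → μ w t)

  möbius-inversion : ∀ a t → ∑ (PBT (leaves t)) (λ w → μ w t * 𝟙 (a ≤? w)) ≡ 𝟙 (a ≟T t)
  möbius-inversion a t with a ≟T t | a ≤? t
  ... | yes refl | _       = möbius-inversion-diag a
  ... | no  _    | no  a≰t = möbius-inversion-≰ a t a≰t
  ... | no  a≢t  | yes a≤t = möbius-inversion-< a t a≢t a≤t

  M-ζ-pairing : ∀ u z → ⟨ M z , ζ u ⟩ ≡ 𝟙 (u ≟B z)
  M-ζ-pairing nothing  nothing  = refl
  M-ζ-pairing (just a) nothing  = refl
  M-ζ-pairing nothing  (just t) =
    trans (∑-map _ (PBT (leaves t)) _) (∑-zero (PBT (leaves t)) (λ w → *-zeroʳ (μ w t)))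
  M-ζ-pairing (just a) (just t) =
    trans (∑-map _ (PBT (leaves t)) _)
          (trans (möbius-inversion a t) (𝟙-⇔ (a ≟T t) (just a ≟B just t) (mk⇔ (cong just) just-injective)))

  ζ-split-sum : ∀ u v w → ∑< (suc (leaves w)) (λ j → uncurry (ζ u ⊠ ζ v) (split j w)) ≡ ζ (u ⋌ v) (just w)
  ζ-split-sum u v w =
    trans (∑<-supported (suc (leaves w)) (deg u) _ other-cuts) (cut-at-deg-u (deg u ℕ.<? suc (leaves w)))
    where
    other-cuts : ∀ j → j < suc (leaves w) → j ≢ deg u → uncurry (ζ u ⊠ ζ v) (split j w) ≡ 0ℤ
    other-cuts j j≤w j≢u =
      trans (cong (_* ζ v (proj₂ (split j w)))
                  (ζ-deg u (proj₁ (split j w)) (λ u≡j → j≢u (trans (sym (deg-split j w (ℕ.≤-pred j≤w))) (sym u≡j)))))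
            (*-zeroˡ (ζ v (proj₂ (split j w))))
    cut-at-deg-u : (u≤w? : Dec (deg u < suc (leaves w))) →
                   𝟙 u≤w? * uncurry (ζ u ⊠ ζ v) (split (deg u) w) ≡ ζ (u ⋌ v) (just w)
    cut-at-deg-u (yes _) = begin
      1ℤ * (ζ u (proj₁ (split (deg u) w)) * ζ v (proj₂ (split (deg u) w)))
        ≡⟨ *-identityˡ _ ⟩
      ζ u (proj₁ (split (deg u) w)) * ζ v (proj₂ (split (deg u) w))
        ≡⟨ 𝟙-× (u ≤B? proj₁ (split (deg u) w)) (v ≤B? proj₂ (split (deg u) w)) ⟩
      𝟙 (u ≤B? proj₁ (split (deg u) w) ×-dec v ≤B? proj₂ (split (deg u) w))
        ≡⟨ 𝟙-⇔ (u ≤B? proj₁ (split (deg u) w) ×-dec v ≤B? proj₂ (split (deg u) w)) ((u ⋌ v) ≤B? just w)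
               (⋌-split-galois u v w) ⟩
      ζ (u ⋌ v) (just w) ∎
      where open ≡-Reasoning
    cut-at-deg-u (no u≰w) = sym (ζ-deg (u ⋌ v) (just w) (λ u⋌v≡w →
      u≰w (s≤s (ℕ.≤-trans (ℕ.m≤m+n (deg u) (deg v)) (ℕ.≤-reflexive (trans (sym (⋌-deg u v)) u⋌v≡w))))))

  ΔB-ζ⊠ζ-pairing : ∀ u v x → ⟪ ΔB x , ζ u ⊠ ζ v ⟫ ≡ ζ (u ⋌ v) x
  ΔB-ζ⊠ζ-pairing nothing  nothing  nothing  = refl
  ΔB-ζ⊠ζ-pairing nothing  (just _) nothing  = refl
  ΔB-ζ⊠ζ-pairing (just _) nothing  nothing  = refl
  ΔB-ζ⊠ζ-pairing (just _) (just _) nothing  = refl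
  ΔB-ζ⊠ζ-pairing u        v        (just w) = trans (Δtree-pairing w (ζ u ⊠ ζ v)) (ζ-split-sum u v w)

  Δ-ζ⊠ζ-pairing : ∀ U u v → ⟪ Δ U , ζ u ⊠ ζ v ⟫ ≡ ⟨ U , ζ (u ⋌ v) ⟩
  Δ-ζ⊠ζ-pairing U u v =
    trans (Δ-pairing U (ζ u ⊠ ζ v)) (∑-cong U (λ (c , x) → cong (c *_) (ΔB-ζ⊠ζ-pairing u v x)))

  ζ-transform : ℕ → (Basis → ℤ) → Basis → ℤ
  ζ-transform p f u = ∑ (basisOfDegree p) (λ a → ζ u a * f a)

  module _ (p : ℕ) where

    ζ-transform-cong : ∀ {f g} u → (∀ a → f a ≡ g a) → ζ-transform p f u ≡ ζ-transform p g u
    ζ-transform-cong u f≗g = ∑-cong (basisOfDegree p) (λ a → cong (ζ u a *_) (f≗g a))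

    ζ-transform-+ : ∀ f g u → ζ-transform p (λ a → f a + g a) u ≡ ζ-transform p f u + ζ-transform p g u
    ζ-transform-+ f g u = trans (∑-cong (basisOfDegree p) (λ a → *-distribˡ-+ (ζ u a) (f a) (g a)))
                                (∑-distrib-+ (basisOfDegree p) _ _)

    ζ-transform-* : ∀ c f u → ζ-transform p (λ a → c * f a) u ≡ c * ζ-transform p f u
    ζ-transform-* c f u = trans (∑-cong (basisOfDegree p) (λ a → swap (ζ u a) c (f a)))
                                (sym (*-distribˡ-∑ c (basisOfDegree p) _))
      where
      swap : ∀ x c y → x * (c * y) ≡ c * (x * y)
      swap = solve-∀

    ζ-transform-- : ∀ f g u → ζ-transform p (λ a → f a - g a) u ≡ ζ-transform p f u - ζ-transform p g u
    ζ-transform-- f g u = begin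
      ζ-transform p (λ a → f a - g a) u
        ≡⟨ ζ-transform-+ f (λ a → - g a) u ⟩
      ζ-transform p f u + ζ-transform p (λ a → - g a) u
        ≡⟨ cong (ζ-transform p f u +_) (trans (ζ-transform-cong u (λ a → neg (g a))) (ζ-transform-* (- 1ℤ) g u)) ⟩
      ζ-transform p f u + - 1ℤ * ζ-transform p g u
        ≡⟨ cong (ζ-transform p f u +_) (sym (neg (ζ-transform p g u))) ⟩
      ζ-transform p f u - ζ-transform p g u ∎
      where
      open ≡-Reasoning
      neg : ∀ x → - x ≡ - 1ℤ * x
      neg = solve-∀

    ζ-transform-𝟙 : ∀ u a → deg u ≡ p → ζ-transform p (λ x → 𝟙 (a ≟B x)) u ≡ ζ u a
    ζ-transform-𝟙 u a du = begin
      ∑ (basisOfDegree p) (λ x → ζ u x * 𝟙 (a ≟B x))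
        ≡⟨ ∑-cong (basisOfDegree p) (λ x → *-comm (ζ u x) (𝟙 (a ≟B x))) ⟩
      ∑ (basisOfDegree p) (λ x → 𝟙 (a ≟B x) * ζ u x)
        ≡⟨ ∑-pick _≟B_ (basisOfDegree p) a (ζ u) ⟩
      multiplicity _≟B_ a (basisOfDegree p) * ζ u a
        ≡⟨ cong (_* ζ u a) (multiplicity-basisOfDegree a p) ⟩
      𝟙 (deg a ℕ.≟ p) * ζ u a
        ≡⟨ degree-match (deg a ℕ.≟ p) ⟩
      ζ u a ∎
      where
      open ≡-Reasoning
      degree-match : (a? : Dec (deg a ≡ p)) → 𝟙 a? * ζ u a ≡ ζ u a
      degree-match (yes _)   = *-identityˡ (ζ u a)
      degree-match (no da≢p) = sym (ζ-deg u a (λ du≡da → da≢p (trans (sym du≡da) du)))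

    -- ζ is unitriangular for the order ≤B, whose strict part decreases ΦB.
    ζ-transform≡0⇒≡0 : ∀ f → (∀ u → deg u ≡ p → ζ-transform p f u ≡ 0ℤ) → ∀ x → deg x ≡ p → f x ≡ 0ℤ
    ζ-transform≡0⇒≡0 f kernel x = go x (<-wellFounded (ΦB x))
      where
      go : ∀ x → Acc _<_ (ΦB x) → deg x ≡ p → f x ≡ 0ℤ
      go x (acc smaller) dx = trans (sym diagonal) (kernel x dx)
        where
        above-x : ∀ y → y ≢ x → ζ x y * f y ≡ 0ℤ
        above-x y y≢x with x ≤B? y
        ... | yes x≤y = trans (*-identityˡ (f y))
                              (go y (smaller (<B-ΦB x≤y (y≢x ∘ sym))) (trans (sym (≤B-deg x≤y)) dx))
        ... | no  _   = refl
        diagonal : ζ-transform p f x ≡ f x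
        diagonal = begin
          ∑ (basisOfDegree p) (λ y → ζ x y * f y)
            ≡⟨ ∑-supported _≟B_ (basisOfDegree p) x _ above-x ⟩
          multiplicity _≟B_ x (basisOfDegree p) * (ζ x x * f x)
            ≡⟨ cong₂ (λ m z → m * (z * f x)) (multiplicity-basisOfDegree x p) (𝟙-yes (x ≤B? x) ≤B-refl) ⟩
          𝟙 (deg x ℕ.≟ p) * (1ℤ * f x)
            ≡⟨ cong (_* (1ℤ * f x)) (𝟙-yes (deg x ℕ.≟ p) dx) ⟩
          1ℤ * (1ℤ * f x)
            ≡⟨ trans (*-identityˡ _) (*-identityˡ (f x)) ⟩
          f x ∎
          where open ≡-Reasoning

  ζ-transform² : ℕ → ℕ → (Basis → Basis → ℤ) → Basis → Basis → ℤ
  ζ-transform² p q D u v = ζ-transform p (λ a → ζ-transform q (D a) v) u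

  ζ-transform²≡0⇒≡0 : ∀ p q (D : Basis → Basis → ℤ) →
    (∀ u v → deg u ≡ p → deg v ≡ q → ζ-transform² p q D u v ≡ 0ℤ) →
    ∀ x y → deg x ≡ p → deg y ≡ q → D x y ≡ 0ℤ
  ζ-transform²≡0⇒≡0 p q D kernel x y dx dy =
    ζ-transform≡0⇒≡0 q (D x)
      (λ v dv → ζ-transform≡0⇒≡0 p (λ a → ζ-transform q (D a) v) (λ u du → kernel u v du dv) x dx) y dy

  ζ⊠ζ-pairing-as-ζ-transform : ∀ X u v →
    ⟪ X , ζ u ⊠ ζ v ⟫ ≡ ζ-transform² (deg u) (deg v) (coeff X) u v
  ζ⊠ζ-pairing-as-ζ-transform []                u v =
    sym (∑-zero (basisOfDegree (deg u)) (λ a → trans (cong (ζ u a *_)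
          (∑-zero (basisOfDegree (deg v)) (λ b → *-zeroʳ (ζ v b)))) (*-zeroʳ (ζ u a))))
  ζ⊠ζ-pairing-as-ζ-transform ((c , a , b) ∷ X) u v = begin
    c * (ζ u a * ζ v b) + ⟪ X , ζ u ⊠ ζ v ⟫
      ≡⟨ cong₂ _+_ (reorder c (ζ u a) (ζ v b)) (ζ⊠ζ-pairing-as-ζ-transform X u v) ⟩
    c * ζ v b * ζ u a + Zᵤ (λ x → Zᵥ (coeff X x))
      ≡⟨ cong (_+ Zᵤ (λ x → Zᵥ (coeff X x))) (sym (trans (ζ-transform-* (deg u) (c * ζ v b) _ u)
                                                         (cong (c * ζ v b *_) (ζ-transform-𝟙 (deg u) u a refl)))) ⟩
    Zᵤ (λ x → c * ζ v b * 𝟙 (a ≟B x)) + Zᵤ (λ x → Zᵥ (coeff X x))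
      ≡⟨ ζ-transform-+ (deg u) _ _ u ⟨
    Zᵤ (λ x → c * ζ v b * 𝟙 (a ≟B x) + Zᵥ (coeff X x))
      ≡⟨ ζ-transform-cong (deg u) u (λ x → cong (_+ Zᵥ (coeff X x)) (new-term x)) ⟨
    Zᵤ (λ x → Zᵥ (λ y → c * 𝟙 (a ≟B x) * 𝟙 (b ≟B y)) + Zᵥ (coeff X x))
      ≡⟨ ζ-transform-cong (deg u) u (λ x → ζ-transform-+ (deg v) _ (coeff X x) v) ⟨
    Zᵤ (λ x → Zᵥ (λ y → c * 𝟙 (a ≟B x) * 𝟙 (b ≟B y) + coeff X x y))
      ≡⟨ ζ-transform-cong (deg u) u (λ x → ζ-transform-cong (deg v) v (coeff-∷ c a b X x)) ⟨
    Zᵤ (λ x → Zᵥ (coeff ((c , a , b) ∷ X) x)) ∎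
    where
    open ≡-Reasoning
    Zᵤ : (Basis → ℤ) → ℤ
    Zᵤ f = ζ-transform (deg u) f u
    Zᵥ : (Basis → ℤ) → ℤ
    Zᵥ f = ζ-transform (deg v) f v
    reorder : ∀ c x y → c * (x * y) ≡ c * y * x
    reorder = solve-∀
    new-term : ∀ x → Zᵥ (λ y → c * 𝟙 (a ≟B x) * 𝟙 (b ≟B y)) ≡ c * ζ v b * 𝟙 (a ≟B x)
    new-term x = trans (ζ-transform-* (deg v) (c * 𝟙 (a ≟B x)) _ v)
                       (trans (cong (c * 𝟙 (a ≟B x) *_) (ζ-transform-𝟙 (deg v) v b refl)) (swap c (𝟙 (a ≟B x)) (ζ v b)))
      where
      swap : ∀ c i z → c * i * z ≡ c * z * i
      swap = solve-∀

  ζ⊠ζ-pairing-injective : ∀ X Y → (∀ u v → ⟪ X , ζ u ⊠ ζ v ⟫ ≡ ⟪ Y , ζ u ⊠ ζ v ⟫) →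
                          ∀ x y → coeff X x y ≡ coeff Y x y
  ζ⊠ζ-pairing-injective X Y agree x y =
    i-j≡0⇒i≡j _ _ (ζ-transform²≡0⇒≡0 (deg x) (deg y) D vanish x y refl refl)
    where
    D : Basis → Basis → ℤ
    D a b = coeff X a b - coeff Y a b
    vanish : ∀ u v → deg u ≡ deg x → deg v ≡ deg y → ζ-transform² (deg x) (deg y) D u v ≡ 0ℤ
    vanish u v du dv rewrite sym du | sym dv = begin
      ζ-transform² (deg u) (deg v) D u v
        ≡⟨ ζ-transform-cong (deg u) u (λ a → ζ-transform-- (deg v) (coeff X a) (coeff Y a) v) ⟩
      ζ-transform (deg u) (λ a → ζ-transform (deg v) (coeff X a) v - ζ-transform (deg v) (coeff Y a) v) u
        ≡⟨ ζ-transform-- (deg u) _ _ u ⟩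
      ζ-transform² (deg u) (deg v) (coeff X) u v - ζ-transform² (deg u) (deg v) (coeff Y) u v
        ≡⟨ cong₂ _-_ (ζ⊠ζ-pairing-as-ζ-transform X u v) (ζ⊠ζ-pairing-as-ζ-transform Y u v) ⟨
      ⟪ X , ζ u ⊠ ζ v ⟫ - ⟪ Y , ζ u ⊠ ζ v ⟫
        ≡⟨ i≡j⇒i-j≡0 (agree u v) ⟩
      0ℤ ∎
      where open ≡-Reasoning

  rhs-pairing : ∀ t u v → ⟪ rhs t , ζ u ⊠ ζ v ⟫ ≡ 𝟙 ((u ⋌ v) ≟B just t)
  rhs-pairing t u v = begin
    ⟪ rhs t , ζ u ⊠ ζ v ⟫
      ≡⟨ ∑-concatMap _ L _ ⟩
    ∑ L (λ z₁ → ⟪ concatMap (λ z₂ → M z₁ ⊗ M z₂) (filter (factorises z₁) L) , ζ u ⊠ ζ v ⟫)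
      ≡⟨ ∑-cong L (λ z₁ → trans (∑-concatMap _ (filter (factorises z₁) L) _) (∑-filter (factorises z₁) L _)) ⟩
    ∑ L (λ z₁ → ∑ L (λ z₂ → 𝟙 (factorises z₁ z₂) * ⟪ M z₁ ⊗ M z₂ , ζ u ⊠ ζ v ⟫))
      ≡⟨ ∑-cong L (λ z₁ → ∑-cong L (λ z₂ → cong (𝟙 (factorises z₁ z₂) *_) (M⊗M-pairing z₁ z₂))) ⟩
    ∑ L (λ z₁ → ∑ L (λ z₂ → 𝟙 (factorises z₁ z₂) * (𝟙 (u ≟B z₁) * 𝟙 (v ≟B z₂))))
      ≡⟨ ∑-cong L (λ z₁ → trans (∑-cong L (λ z₂ → reorder (𝟙 (factorises z₁ z₂)) (𝟙 (u ≟B z₁)) (𝟙 (v ≟B z₂))))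
                                (sym (*-distribˡ-∑ (𝟙 (u ≟B z₁)) L _))) ⟩
    ∑ L (λ z₁ → 𝟙 (u ≟B z₁) * ∑ L (λ z₂ → 𝟙 (v ≟B z₂) * 𝟙 (factorises z₁ z₂)))
      ≡⟨ ∑-pick _≟B_ L u _ ⟩
    multiplicity _≟B_ u L * ∑ L (λ z₂ → 𝟙 (v ≟B z₂) * 𝟙 (factorises u z₂))
      ≡⟨ cong (multiplicity _≟B_ u L *_) (∑-pick _≟B_ L v _) ⟩
    multiplicity _≟B_ u L * (multiplicity _≟B_ v L * 𝟙 (factorises u v))
      ≡⟨ factors-listed (factorises u v) ⟩
    𝟙 ((u ⋌ v) ≟B just t) ∎
    where
    open ≡-Reasoning
    L : List Basis
    L = basis≤ (leaves t)
    factorises : (z₁ z₂ : Basis) → Dec (z₁ ⋌ z₂ ≡ just t)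
    factorises z₁ z₂ = (z₁ ⋌ z₂) ≟B just t
    M⊗M-pairing : ∀ z₁ z₂ → ⟪ M z₁ ⊗ M z₂ , ζ u ⊠ ζ v ⟫ ≡ 𝟙 (u ≟B z₁) * 𝟙 (v ≟B z₂)
    M⊗M-pairing z₁ z₂ = trans (⊗-pairing (M z₁) (M z₂) (ζ u) (ζ v)) (cong₂ _*_ (M-ζ-pairing u z₁) (M-ζ-pairing v z₂))
    reorder : ∀ i x y → i * (x * y) ≡ x * (y * i)
    reorder = solve-∀
    factors-listed : (u⋌v≟t : Dec (u ⋌ v ≡ just t)) →
                     multiplicity _≟B_ u L * (multiplicity _≟B_ v L * 𝟙 u⋌v≟t) ≡ 𝟙 u⋌v≟t
    factors-listed (no _)       = trans (cong (multiplicity _≟B_ u L *_) (*-zeroʳ (multiplicity _≟B_ v L)))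
                                        (*-zeroʳ (multiplicity _≟B_ u L))
    factors-listed (yes u⋌v≡t) =
      cong₂ (λ m m' → m * (m' * 1ℤ)) (proj₁ (⋌-factors-listed {u} {v} u⋌v≡t)) (proj₂ (⋌-factors-listed {u} {v} u⋌v≡t))

theorem2p29 : (_≤?_ : Decidable _≤T_) (t : Tree) (x y : Basis)
    → coeff (Δ (MBasis.M _≤?_ (just t))) x y ≡ coeff (MBasis.rhs _≤?_ t) x y
theorem2p29 _≤?_ t = ζ⊠ζ-pairing-injective (Δ (M (just t))) (rhs t) pairings-agree
  where
  open MBasis _≤?_
  open Zeta _≤?_
  open ≡-Reasoning
  pairings-agree : ∀ u v → ⟪ Δ (M (just t)) , ζ u ⊠ ζ v ⟫ ≡ ⟪ rhs t , ζ u ⊠ ζ v ⟫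
  pairings-agree u v = begin
    ⟪ Δ (M (just t)) , ζ u ⊠ ζ v ⟫ ≡⟨ Δ-ζ⊠ζ-pairing (M (just t)) u v ⟩
    ⟨ M (just t) , ζ (u ⋌ v) ⟩     ≡⟨ M-ζ-pairing (u ⋌ v) (just t) ⟩
    𝟙 ((u ⋌ v) ≟B just t)          ≡⟨ rhs-pairing t u v ⟨
    ⟪ rhs t , ζ u ⊠ ζ v ⟫          ∎
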